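{- For every positive integer $n$ and every $\pi\in S_n$ there is a natural number $s\ge 1$ such that $T^{s}(\pi)=\pi$.
   Context: Permutations $\pi\in S_n$ are written in one-line notation $\pi=\pi_1\pi_2\cdots\pi_n$. The topdrop map $T:S_n\to S_n$ is defined by $T(\pi_1\cdots\pi_n)=\pi_{\pi_1+1}\cdots\pi_n\,\pi_{\pi_1}\pi_{\pi_1-1}\cdots\pi_1$ (the first $\pi_1$ entries are removed, reversed and appended at the end). $T^s$ denotes the $s$-fold composition of $T$. -}

module Defs where

open import Data.Nat using (ℕ; zero; suc)
open import Data.List using (List; []; _∷_; _++_; take; drop; reverse; map; upTo)
open import Data.List.Relation.Binary.Permutation.Propositional using (_↭_)

IsPermOf : ℕ → List ℕ → Set
IsPermOf n π = π ↭ map suc (upTo n)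

-- The topdrop map: T(π₁⋯πₙ) = π_{π₁+1}⋯πₙ π_{π₁}⋯π₁
-- (remove the first π₁ entries, reverse them, append them at the end).
-- On the empty list (never a permutation for n ≥ 1) it is the identity.
topdrop : List ℕ → List ℕ
topdrop []          = []
topdrop (a ∷ rest)  = drop a (a ∷ rest) ++ reverse (take a (a ∷ rest))

iter : {A : Set} → (A → A) → ℕ → A → A
iter f zero    x = x
iter f (suc s) x = f (iter f s x)

{-# OPTIONS --safe #-}
module Submission where

open import Defs
open import Data.Nat using (ℕ; zero; suc; _≤_; _+_; z≤n; s≤s)
open import Data.Nat.Properties using (m≤n⇒∃[o]m+o≡n; +-suc; n<1+n)
open import Data.Fin using (toℕ)
open import Data.Fin.Properties using (pigeonhole)
open import Data.List using (List; []; _∷_; [_]; _++_; take; drop; reverse; map; upTo; length; cartesianProductWith)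
open import Data.List.Properties using (reverse-++; reverse-involutive; take++drop≡id; length-map; length-upTo)
open import Data.List.Membership.Propositional using (_∈_)
open import Data.List.Membership.Propositional.Properties using (∈-map⁻; ∈-upTo⁻; ∈-cartesianProductWith⁺)
open import Data.List.Membership.Setoid.Properties using (index-injective)
open import Data.List.Relation.Unary.Any using (here; index)
open import Data.List.Relation.Unary.All as All using (All; []; _∷_)
open import Data.List.Relation.Binary.Permutation.Propositional using (_↭_; ↭-refl; ↭-sym; ↭-trans; module PermutationReasoning)
open import Data.List.Relation.Binary.Permutation.Propositional.Properties using (∈-resp-↭; ↭-length; ↭-reverse; ++-comm; ++⁺ˡ)
open import Data.Product using (Σ; _×_; _,_; ∃₂)
open import Function using (_∘_)
open import Relation.Binary.PropositionalEquality using (_≡_; refl; sym; trans; cong; subst; setoid; module ≡-Reasoning)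

-- Write π = a ∷ ys ++ zs with length ys = a - 1. Then T π = zs ++ reverse (a ∷ ys), and
-- reverse ∘ T ∘ reverse undoes this, so T is injective on S_n. An injective self-map of
-- the finite set S_n is a bijection of it, hence every orbit of T is a cycle: by pigeonhole
-- two iterates T^i π = T^j π with i < j coincide, and cancelling T^i gives T^(j-i) π = π.

private
  variable
    A : Set

take-length-++ : (xs ys : List A) → take (length xs) (xs ++ ys) ≡ xs
take-length-++ []       ys = refl
take-length-++ (x ∷ xs) ys = cong (x ∷_) (take-length-++ xs ys)

drop-length-++ : (xs ys : List A) → drop (length xs) (xs ++ ys) ≡ ys
drop-length-++ []       ys = refl
drop-length-++ (x ∷ xs) ys = drop-length-++ xs ys

reverse-++-reverse : (xs ys : List A) → reverse (xs ++ reverse ys) ≡ ys ++ reverse xs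
reverse-++-reverse xs ys = trans (reverse-++ xs (reverse ys)) (cong (_++ reverse xs) (reverse-involutive ys))

∃-prefix-of-length : ∀ k (xs : List A) → k ≤ length xs → ∃₂ λ ys zs → k ≡ length ys × xs ≡ ys ++ zs
∃-prefix-of-length zero    xs       _         = [] , xs , refl , refl
∃-prefix-of-length (suc k) (x ∷ xs) (s≤s k≤n) with ys , zs , refl , refl ← ∃-prefix-of-length k xs k≤n =
  x ∷ ys , zs , refl , refl

listsOfLength : List A → ℕ → List (List A)
listsOfLength xs zero    = [ [] ]
listsOfLength xs (suc n) = cartesianProductWith _∷_ xs (listsOfLength xs n)

∈-listsOfLength : {xs ys : List A} → All (_∈ xs) ys → ys ∈ listsOfLength xs (length ys)
∈-listsOfLength []           = here refl
∈-listsOfLength (y∈xs ∷ ys∈) = ∈-cartesianProductWith⁺ _∷_ y∈xs (∈-listsOfLength ys∈)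

module _ (f : A → A) {P : A → Set}
         (f-pres : ∀ {x} → P x → P (f x))
         (f-injective : ∀ {x y} → P x → P y → f x ≡ f y → x ≡ y) where

  iter-pres : ∀ {x} → P x → ∀ i → P (iter f i x)
  iter-pres px zero    = px
  iter-pres px (suc i) = f-pres (iter-pres px i)

  iter-cancelˡ : ∀ {x} → P x → ∀ i {s} → iter f i x ≡ iter f (i + s) x → x ≡ iter f s x
  iter-cancelˡ px zero    eq = eq
  iter-cancelˡ px (suc i) {s} eq =
    iter-cancelˡ px i (f-injective (iter-pres px i) (iter-pres px (i + s)) eq)

  finite-injective⇒periodic : (U : List A) → (∀ {x} → P x → x ∈ U) →
             ∀ {x} → P x → Σ ℕ (λ s → (1 ≤ s) × (iter f s x ≡ x))
  finite-injective⇒periodic U covers {x} px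
    with i , j , i<j , same-index ← pigeonhole (n<1+n _) (index ∘ covers ∘ iter-pres px ∘ toℕ)
    with k , i+1+k≡j ← m≤n⇒∃[o]m+o≡n i<j =
    suc k , s≤s z≤n , sym (iter-cancelˡ px (toℕ i) orbit-repeats)
    where
    orbit-repeats : iter f (toℕ i) x ≡ iter f (toℕ i + suc k) x
    orbit-repeats = trans (index-injective (setoid A) _ _ same-index)
                          (cong (λ m → iter f m x) (sym (trans (+-suc (toℕ i) k) i+1+k≡j)))

topdrop-↭ : (xs : List ℕ) → topdrop xs ↭ xs
topdrop-↭ []           = ↭-refl
topdrop-↭ xs@(a ∷ _) = begin
  drop a xs ++ reverse (take a xs)  ↭⟨ ++⁺ˡ (drop a xs) (↭-reverse (take a xs)) ⟩
  drop a xs ++ take a xs            ↭⟨ ++-comm (drop a xs) (take a xs) ⟩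
  take a xs ++ drop a xs            ≡⟨ take++drop≡id a xs ⟩
  xs                                ∎
  where open PermutationReasoning

topdrop-block : (ys zs : List ℕ) → topdrop (suc (length ys) ∷ ys ++ zs) ≡ zs ++ reverse (suc (length ys) ∷ ys)
topdrop-block ys zs
  rewrite drop-length-++ ys zs | take-length-++ ys zs = refl

untopdrop : List ℕ → List ℕ
untopdrop = reverse ∘ topdrop ∘ reverse

untopdrop-topdrop-block : (ys zs : List ℕ) → untopdrop (topdrop (suc (length ys) ∷ ys ++ zs)) ≡ suc (length ys) ∷ ys ++ zs
untopdrop-topdrop-block ys zs = begin
  reverse (topdrop (reverse (topdrop (a ∷ ys ++ zs))))       ≡⟨ cong (reverse ∘ topdrop ∘ reverse) (topdrop-block ys zs) ⟩
  reverse (topdrop (reverse (zs ++ reverse (a ∷ ys))))       ≡⟨ cong (reverse ∘ topdrop) (reverse-++-reverse zs (a ∷ ys)) ⟩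
  reverse (topdrop (a ∷ ys ++ reverse zs))                   ≡⟨ cong reverse (topdrop-block ys (reverse zs)) ⟩
  reverse (reverse zs ++ reverse (a ∷ ys))                   ≡⟨ reverse-++-reverse (reverse zs) (a ∷ ys) ⟩
  a ∷ ys ++ reverse (reverse zs)                             ≡⟨ cong (λ ws → a ∷ ys ++ ws) (reverse-involutive zs) ⟩
  a ∷ ys ++ zs                                               ∎
  where
  open ≡-Reasoning
  a = suc (length ys)

IsPermOf-topdrop : ∀ {n xs} → IsPermOf n xs → IsPermOf n (topdrop xs)
IsPermOf-topdrop {xs = xs} p = ↭-trans (topdrop-↭ xs) p

IsPermOf-length : ∀ {n xs} → IsPermOf n xs → length xs ≡ n
IsPermOf-length {n} p = trans (↭-length p) (trans (length-map suc (upTo n)) (length-upTo n))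

IsPermOf-head-block : ∀ {n xs} → IsPermOf (suc n) xs → ∃₂ λ ys zs → xs ≡ suc (length ys) ∷ ys ++ zs
IsPermOf-head-block {xs = []} p with () ← ∈-resp-↭ (↭-sym p) (here refl)
IsPermOf-head-block {xs = a ∷ rest} p
  with k , k∈upTo , refl ← ∈-map⁻ suc (∈-resp-↭ p (here refl))
  with s≤s k≤length ← subst (suc k ≤_) (sym (IsPermOf-length p)) (∈-upTo⁻ k∈upTo)
  with ys , zs , refl , refl ← ∃-prefix-of-length k rest k≤length =
  ys , zs , refl

topdrop-injective : ∀ {n xs ys} → IsPermOf (suc n) xs → IsPermOf (suc n) ys → topdrop xs ≡ topdrop ys → xs ≡ ys
topdrop-injective pxs pys eq
  with ys₁ , zs₁ , refl ← IsPermOf-head-block pxs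
  with ys₂ , zs₂ , refl ← IsPermOf-head-block pys =
  trans (sym (untopdrop-topdrop-block ys₁ zs₁)) (trans (cong untopdrop eq) (untopdrop-topdrop-block ys₂ zs₂))

IsPermOf⇒∈-listsOfLength : ∀ {n xs} → IsPermOf n xs → xs ∈ listsOfLength (map suc (upTo n)) n
IsPermOf⇒∈-listsOfLength p =
  subst (λ m → _ ∈ listsOfLength _ m) (IsPermOf-length p) (∈-listsOfLength (All.tabulate (∈-resp-↭ p)))

proposition2p4 : (n : ℕ) → 1 ≤ n → (π : List ℕ) → IsPermOf n π →
    Σ ℕ (λ s → (1 ≤ s) × (iter topdrop s π ≡ π))
proposition2p4 (suc n) (s≤s z≤n) π =
  finite-injective⇒periodic topdrop IsPermOf-topdrop topdrop-injective
    (listsOfLength (map suc (upTo (suc n))) (suc n)) IsPermOf⇒∈-listsOfLength
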